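{- If $\pi \in \S_n(321)$ then $f_n(\pi)^{ -1}(n) = \pi^{ -1}(n)$.
   Context: $\S_n(321)$ is the set of $321$-avoiding permutations in $\S_n$, and $\mathrm{bl}(\pi)=|\{i : \pi(j)\le i \text{ for all } j\le i\}|$ is the block number. Maps $f_n:\S_n(321)\to\S_n(321)$ are defined recursively: $f_1$ is the identity on $\S_1$. For $\pi\in\S_n(321)$, $n\ge2$, let $k=\mathrm{bl}(\pi)$. Case A: $\pi^{ -1}(n)=n$: delete $n$, apply $f_{n-1}$, and insert $n$ at the last position. Case B: $\pi^{ -1}(n-1)<\pi^{ -1}(n)<n$: delete $n$, apply $f_{n-1}$, insert $n$ at the same position as in $\pi$, and multiply on the left by the transposition $(n-k-1,n-k)$. Case C: $\pi^{ -1}(n)<\pi^{ -1}(n-1)$ (so $n-1$ is the last letter): let $\pi'=(n-1,n)\pi$, compute $f_n(\pi')$ as in case A, and multiply it on the left by the cycle $(n-k,n-k+1,\dots,n)$. (Left multiplication acts on the values.) -}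

module Defs where

open import Data.Nat using (ℕ; zero; suc; _+_; _∸_; _≤_; _<_; _⊔_; _≡ᵇ_; _<ᵇ_; _≤ᵇ_)
open import Data.Bool using (Bool; true; false; if_then_else_; not)
open import Data.List using (List; []; _∷_; _++_; [_]; map; filter; length; take; foldr; upTo; lookup; filterᵇ)
open import Data.List.Relation.Binary.Permutation.Propositional using (_↭_)
open import Data.Fin as Fin using (Fin)
open import Data.Product using (_×_)
open import Relation.Nullary using (¬_)

-- Permutations of [n] = {1,…,n} are represented in one-line notation as
-- lists of naturals: π = [π(1), …, π(n)].

IsPerm : ℕ → List ℕ → Set
IsPerm n π = π ↭ map suc (upTo n)

Avoids321 : List ℕ → Set
Avoids321 π = (i j k : Fin (length π)) → i Fin.< j → j Fin.< k →
  ¬ (lookup π j < lookup π i × lookup π k < lookup π j)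

S321 : ℕ → List ℕ → Set
S321 n π = IsPerm n π × Avoids321 π

-- 1-based position of the first occurrence of v in a list
-- (so pos v π = π⁻¹(v) when π is a permutation containing v)
pos : ℕ → List ℕ → ℕ
pos v [] = 1
pos v (x ∷ xs) = if x ≡ᵇ v then 1 else suc (pos v xs)

maxL : List ℕ → ℕ
maxL = foldr _⊔_ 0

bl : ℕ → List ℕ → ℕ
bl n π = length (filterᵇ (λ i → maxL (take i π) ≤ᵇ i) (map suc (upTo n)))

deleteV : ℕ → List ℕ → List ℕ
deleteV v = filterᵇ (λ x → not (x ≡ᵇ v))

-- insert x so that it occupies (1-based) position p
insertAt : ℕ → ℕ → List ℕ → List ℕ
insertAt zero x xs = x ∷ xs
insertAt (suc zero) x xs = x ∷ xs
insertAt (suc (suc p)) x [] = x ∷ []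
insertAt (suc (suc p)) x (y ∷ ys) = y ∷ insertAt (suc p) x ys

transp : ℕ → ℕ → ℕ → ℕ
transp a b v = if v ≡ᵇ a then b else (if v ≡ᵇ b then a else v)

cyc : ℕ → ℕ → ℕ → ℕ
cyc a b v = if (a ≤ᵇ v) Data.Bool.∧ (v <ᵇ b) then suc v else (if v ≡ᵇ b then a else v)

leftMul : (ℕ → ℕ) → List ℕ → List ℕ
leftMul σ = map σ

-- the maps f_n : S_n(321) → S_n(321)  (defined on all lists; the cases
-- agree with the paper's cases A, B, C on 321-avoiding permutations)
f : ℕ → List ℕ → List ℕ
f zero π = π
f (suc zero) π = π
f (suc (suc m)) π =
  if pos n π ≡ᵇ n
    -- Case A: π⁻¹(n) = n
    then f (suc m) (deleteV n π) ++ [ n ]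
    else (if pos (suc m) π <ᵇ pos n π
      -- Case B: π⁻¹(n-1) < π⁻¹(n) < n
      then leftMul (transp (n ∸ k ∸ 1) (n ∸ k)) (insertAt (pos n π) n (f (suc m) (deleteV n π)))
      -- Case C: π⁻¹(n) < π⁻¹(n-1); π' = (n-1,n)π, f_n(π') by case A
      else leftMul (cyc (n ∸ k) n) (f (suc m) (deleteV n π') ++ [ n ]))
  where
    n = suc (suc m)
    k = bl n π
    π' = leftMul (transp (suc m) n) π

-- In case A, n is appended at
-- the end. In case B, n is re-inserted at its old position, and the transposition
-- (n-k-1, n-k) fixes n because bl(π) ≥ 1. In case C, the cycle (n-k, …, n) sends
-- only n-1 to n, so n ends up where n-1 sits in f_{n-1}(π' without n); by
-- induction that is the position of n-1 in π' = (n-1, n)π, i.e. of n in π.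
module Submission where

open import Defs
open import Data.Bool using (true; false; T; _∧_)
open import Data.Bool.Properties using (T-≡)
open import Data.Empty using (⊥-elim)
open import Data.List using (List; []; _∷_; _++_; [_]; map; length; take; upTo)
open import Data.List.Properties using (map-++; length-map; length-++; filter-++; upTo-∷ʳ; length-upTo; ++-assoc; ++-identityʳ; map-id-local)
open import Data.List.Membership.Propositional using (_∈_)
open import Data.List.Membership.Propositional.Properties using (∈-++⁺ʳ; ∈-filter⁺)
open import Data.List.Relation.Binary.Permutation.Propositional using (↭-sym; ↭-trans; ↭-refl; ↭-reflexive; ↭-swap; module PermutationReasoning)
open import Data.List.Relation.Binary.Permutation.Propositional.Properties using (filter-↭; map⁺; ↭-length; ∈-resp-↭; All-resp-↭; ++⁺ˡ)
open import Data.List.Relation.Unary.All using (All; []; _∷_)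
import Data.List.Relation.Unary.All as All
import Data.List.Relation.Unary.All.Properties as All
open import Data.List.Relation.Unary.Any using (here; there)
open import Data.Nat using (ℕ; zero; suc; _∸_; _≤_; _<_; _≮_; _≡ᵇ_; _<ᵇ_; _≤ᵇ_; z≤n; s≤s)
open import Data.Nat.Properties
open import Data.Product using (_,_)
open import Function using (_∘_)
open import Function.Bundles using (Equivalence)
open import Relation.Nullary.Decidable using (T?)
open import Relation.Binary.PropositionalEquality using (_≡_; _≢_; refl; sym; trans; cong; cong₂; subst; subst₂; module ≡-Reasoning)

private
  variable
    a b m n v w x : ℕ
    xs : List ℕ

≡ᵇ-true⇒≡ : (m ≡ᵇ n) ≡ true → m ≡ n
≡ᵇ-true⇒≡ {m} {n} e = ≡ᵇ⇒≡ m n (subst T (sym e) _)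

≡ᵇ-false⇒≢ : (m ≡ᵇ n) ≡ false → m ≢ n
≡ᵇ-false⇒≢ {m} e refl = subst T e (≡⇒≡ᵇ m m refl)

≡ᵇ-refl : ∀ n → (n ≡ᵇ n) ≡ true
≡ᵇ-refl n = Equivalence.to T-≡ (≡⇒≡ᵇ n n refl)

<ᵇ-false⇒≮ : (m <ᵇ n) ≡ false → m ≮ n
<ᵇ-false⇒≮ e m<n = subst T e (<⇒<ᵇ m<n)

≤⇒≢suc : m ≤ n → m ≢ suc n
≤⇒≢suc m≤n = <⇒≢ (s≤s m≤n)

weaken-≤ : All (_≤ n) xs → All (_≤ suc n) xs
weaken-≤ = All.map m≤n⇒m≤1+n

1≤pos : ∀ v xs → 1 ≤ pos v xs
1≤pos v [] = s≤s z≤n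
1≤pos v (x ∷ xs) with x ≡ᵇ v
... | true = s≤s z≤n
... | false = s≤s z≤n

pos≤length : v ∈ xs → pos v xs ≤ length xs
pos≤length {v} {x ∷ xs} v∈ with x ≡ᵇ v in e
... | true = s≤s z≤n
pos≤length (here v≡x) | false = ⊥-elim (≡ᵇ-false⇒≢ e (sym v≡x))
pos≤length (there v∈) | false = s≤s (pos≤length v∈)

pos-injective : v ∈ xs → pos v xs ≡ pos w xs → v ≡ w
pos-injective {v} {x ∷ xs} {w} v∈ eq with x ≡ᵇ v in e₁ | x ≡ᵇ w in e₂
... | true  | true  = trans (sym (≡ᵇ-true⇒≡ {x} e₁)) (≡ᵇ-true⇒≡ e₂)
... | true  | false = ⊥-elim (1+n≰n (subst (1 ≤_) (suc-injective (sym eq)) (1≤pos w xs)))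
... | false | true  = ⊥-elim (1+n≰n (subst (1 ≤_) (suc-injective eq) (1≤pos v xs)))
pos-injective (here v≡x) eq | false | false = ⊥-elim (≡ᵇ-false⇒≢ e₁ (sym v≡x))
pos-injective (there v∈) eq | false | false = pos-injective v∈ (suc-injective eq)

pos-++-last : All (_≢ v) xs → pos v (xs ++ [ v ]) ≡ suc (length xs)
pos-++-last {v} [] rewrite ≡ᵇ-refl v = refl
pos-++-last {v} {x ∷ xs} (x≢v ∷ xs∌v) with x ≡ᵇ v in e
... | true = ⊥-elim (x≢v (≡ᵇ-true⇒≡ e))
... | false = cong suc (pos-++-last xs∌v)

-- pos v xs ≤ length xs says that v occurs in xs; otherwise pos v xs = 1 + length xs.
pos-++ˡ : ∀ xs ys → pos v xs ≤ length xs → pos v (xs ++ ys) ≡ pos v xs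
pos-++ˡ {v} (x ∷ xs) ys le with x ≡ᵇ v
... | true = refl
... | false = cong suc (pos-++ˡ xs ys (≤-pred le))

pos-insertAt : ∀ p → All (_≢ v) xs → 1 ≤ p → p ≤ suc (length xs) →
  pos v (insertAt p v xs) ≡ p
pos-insertAt {v} (suc zero) _ _ _ rewrite ≡ᵇ-refl v = refl
pos-insertAt {v} {y ∷ xs} (suc (suc p)) (y≢v ∷ xs∌v) _ (s≤s p≤) with y ≡ᵇ v in e
... | true = ⊥-elim (y≢v (≡ᵇ-true⇒≡ e))
... | false = cong suc (pos-insertAt (suc p) xs∌v (s≤s z≤n) p≤)

pos-map : ∀ (σ : ℕ → ℕ) xs → σ w ≡ v → (∀ x → σ x ≡ v → x ≡ w) →
  pos v (map σ xs) ≡ pos w xs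
pos-map σ [] _ _ = refl
pos-map {w} {v} σ (x ∷ xs) σw≡v only-w with x ≡ᵇ w in e₁ | σ x ≡ᵇ v in e₂
... | true  | true  = refl
... | true  | false = ⊥-elim (≡ᵇ-false⇒≢ e₂ (subst (λ y → σ y ≡ v) (sym (≡ᵇ-true⇒≡ e₁)) σw≡v))
... | false | true  = ⊥-elim (≡ᵇ-false⇒≢ e₁ (only-w x (≡ᵇ-true⇒≡ e₂)))
... | false | false = cong suc (pos-map σ xs σw≡v only-w)

pos-map-involutive : ∀ (σ : ℕ → ℕ) xs → (∀ x → σ (σ x) ≡ x) →
  pos (σ w) (map σ xs) ≡ pos w xs
pos-map-involutive σ xs inv =
  pos-map σ xs refl (λ x σx≡σw → trans (sym (inv x)) (trans (cong σ σx≡σw) (inv _)))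

pos-deleteV : ∀ ys → a ≢ b → pos a ys < pos b ys → pos a (deleteV b ys) ≡ pos a ys
pos-deleteV [] _ (s≤s ())
pos-deleteV {a} {b} (y ∷ ys) a≢b lt with y ≡ᵇ b in e₂ | y ≡ᵇ a in e₁
... | true  | true  = ⊥-elim (a≢b (trans (sym (≡ᵇ-true⇒≡ {y} e₁)) (≡ᵇ-true⇒≡ e₂)))
... | true  | false = ⊥-elim (n≮0 (≤-pred lt))
... | false | true  rewrite e₁ = refl
... | false | false rewrite e₁ = cong suc (pos-deleteV ys a≢b (≤-pred lt))

transp-left : ∀ a b → transp a b a ≡ b
transp-left a b rewrite ≡ᵇ-refl a = refl

transp-right : ∀ a b → transp a b b ≡ a
transp-right a b with b ≡ᵇ a in e
... | true = ≡ᵇ-true⇒≡ e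
... | false rewrite ≡ᵇ-refl b = refl

transp-fixed : v ≢ a → v ≢ b → transp a b v ≡ v
transp-fixed {v} {a} {b} v≢a v≢b with v ≡ᵇ a in e₁
... | true = ⊥-elim (v≢a (≡ᵇ-true⇒≡ e₁))
... | false with v ≡ᵇ b in e₂
...   | true = ⊥-elim (v≢b (≡ᵇ-true⇒≡ e₂))
...   | false = refl

transp-involutive : ∀ a b x → transp a b (transp a b x) ≡ x
transp-involutive a b x with x ≡ᵇ a in e₁
... | true = trans (transp-right a b) (sym (≡ᵇ-true⇒≡ e₁))
... | false with x ≡ᵇ b in e₂
...   | true = trans (transp-left a b) (sym (≡ᵇ-true⇒≡ e₂))
...   | false = transp-fixed (≡ᵇ-false⇒≢ e₁) (≡ᵇ-false⇒≢ e₂)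

transp-≤ : a ≤ n → b ≤ n → x ≤ n → transp a b x ≤ n
transp-≤ {a} {n} {b} {x} a≤n b≤n x≤n with x ≡ᵇ a
... | true = b≤n
... | false with x ≡ᵇ b
...   | true = a≤n
...   | false = x≤n

cyc-last : a ≤ n → cyc a (suc n) n ≡ suc n
cyc-last {a} {n} a≤n rewrite Equivalence.to T-≡ (≤⇒≤ᵇ a≤n) | Equivalence.to T-≡ (<⇒<ᵇ (n<1+n n)) = refl

cyc-preimage-last : a ≢ suc n → cyc a (suc n) x ≡ suc n → x ≡ n
cyc-preimage-last {a} {n} {x} a≢ eq with (a ≤ᵇ x) ∧ (x <ᵇ suc n)
... | true = suc-injective eq
... | false with x ≡ᵇ suc n in e
...   | true = ⊥-elim (a≢ eq)
...   | false = ⊥-elim (≡ᵇ-false⇒≢ e eq)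

cyc-≤ : a ≤ n → x ≤ n → cyc a n x ≤ n
cyc-≤ {a} {n} {x} a≤n x≤n with a ≤ᵇ x | x <ᵇ n in e
... | true  | true = <ᵇ⇒< x n (subst T (sym e) _)
... | true  | false with x ≡ᵇ n
...   | true = a≤n
...   | false = x≤n
cyc-≤ {a} {n} {x} a≤n x≤n | false | _ with x ≡ᵇ n
...   | true = a≤n
...   | false = x≤n

deleteV-∉ : All (_≢ v) xs → deleteV v xs ≡ xs
deleteV-∉ [] = refl
deleteV-∉ {v} {x ∷ xs} (x≢v ∷ xs∌v) with x ≡ᵇ v in e
... | true = ⊥-elim (x≢v (≡ᵇ-true⇒≡ e))
... | false = cong (x ∷_) (deleteV-∉ xs∌v)

deleteV-[_] : ∀ v → deleteV v [ v ] ≡ []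
deleteV-[ v ] rewrite ≡ᵇ-refl v = refl

deleteV-≤ : All (_≤ suc n) xs → All (_≤ n) (deleteV (suc n) xs)
deleteV-≤ [] = []
deleteV-≤ {n} {x ∷ xs} (x≤ ∷ xs≤) with x ≡ᵇ suc n in e
... | true = deleteV-≤ xs≤
... | false = ≤-pred (≤∧≢⇒< x≤ (≡ᵇ-false⇒≢ e)) ∷ deleteV-≤ xs≤

length-insertAt : ∀ p → length (insertAt p v xs) ≡ suc (length xs)
length-insertAt zero = refl
length-insertAt (suc zero) = refl
length-insertAt {xs = []} (suc (suc p)) = refl
length-insertAt {xs = _ ∷ _} (suc (suc p)) = cong suc (length-insertAt (suc p))

All-insertAt : ∀ {P : ℕ → Set} p → P v → All P xs → All P (insertAt p v xs)
All-insertAt zero Pv Pxs = Pv ∷ Pxs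
All-insertAt (suc zero) Pv Pxs = Pv ∷ Pxs
All-insertAt (suc (suc p)) Pv [] = Pv ∷ []
All-insertAt (suc (suc p)) Pv (Py ∷ Pxs) = Py ∷ All-insertAt (suc p) Pv Pxs

oneTo : ℕ → List ℕ
oneTo n = map suc (upTo n)

oneTo-suc : ∀ n → oneTo (suc n) ≡ oneTo n ++ [ suc n ]
oneTo-suc n = trans (cong (map suc) (sym (upTo-∷ʳ n))) (map-++ suc (upTo n) [ n ])

oneTo-≤ : ∀ n → All (_≤ n) (oneTo n)
oneTo-≤ zero = []
oneTo-≤ (suc n) rewrite oneTo-suc n = All.++⁺ (weaken-≤ (oneTo-≤ n)) (≤-refl ∷ [])

last∈oneTo : ∀ n → suc n ∈ oneTo (suc n)
last∈oneTo n rewrite oneTo-suc n = ∈-++⁺ʳ (oneTo n) (here refl)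

length-oneTo : ∀ n → length (oneTo n) ≡ n
length-oneTo n = trans (length-map suc (upTo n)) (length-upTo n)

deleteV-oneTo : ∀ n → deleteV (suc n) (oneTo (suc n)) ≡ oneTo n
deleteV-oneTo n = begin
  deleteV (suc n) (oneTo (suc n))                          ≡⟨ cong (deleteV (suc n)) (oneTo-suc n) ⟩
  deleteV (suc n) (oneTo n ++ [ suc n ])                   ≡⟨ filter-++ _ (oneTo n) [ suc n ] ⟩
  deleteV (suc n) (oneTo n) ++ deleteV (suc n) [ suc n ]   ≡⟨ cong₂ _++_ (deleteV-∉ (All.map ≤⇒≢suc (oneTo-≤ n))) deleteV-[ suc n ] ⟩
  oneTo n ++ []                                            ≡⟨ ++-identityʳ (oneTo n) ⟩
  oneTo n                                                  ∎
  where open ≡-Reasoning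

IsPerm⇒≤ : IsPerm n xs → All (_≤ n) xs
IsPerm⇒≤ {n} p = All-resp-↭ (↭-sym p) (oneTo-≤ n)

IsPerm⇒last∈ : IsPerm (suc n) xs → suc n ∈ xs
IsPerm⇒last∈ {n} p = ∈-resp-↭ (↭-sym p) (last∈oneTo n)

IsPerm⇒length : IsPerm n xs → length xs ≡ n
IsPerm⇒length {n} p = trans (↭-length p) (length-oneTo n)

IsPerm-deleteV : IsPerm (suc n) xs → IsPerm n (deleteV (suc n) xs)
IsPerm-deleteV {n} p = ↭-trans (filter-↭ _ p) (↭-reflexive (deleteV-oneTo n))

swapTop : ℕ → ℕ → ℕ
swapTop m = transp (suc m) (suc (suc m))

IsPerm-swapTop : IsPerm (suc (suc m)) xs → IsPerm (suc (suc m)) (map (swapTop m) xs)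
IsPerm-swapTop {m} p = begin
  map (swapTop m) _                         ↭⟨ map⁺ (swapTop m) p ⟩
  map (swapTop m) (oneTo (suc (suc m)))     ≡⟨ cong (map (swapTop m)) oneTo-split ⟩
  map (swapTop m) (oneTo m ++ top)          ≡⟨ map-++ (swapTop m) (oneTo m) top ⟩
  map (swapTop m) (oneTo m) ++ map (swapTop m) top
    ≡⟨ cong₂ _++_ fixes-oneTo (cong₂ _∷_ (transp-left (suc m) (suc (suc m))) (cong₂ _∷_ (transp-right (suc m) (suc (suc m))) refl)) ⟩
  oneTo m ++ suc (suc m) ∷ suc m ∷ []       ↭⟨ ++⁺ˡ (oneTo m) (↭-swap _ _ ↭-refl) ⟩
  oneTo m ++ top                            ≡⟨ sym oneTo-split ⟩
  oneTo (suc (suc m))                       ∎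
  where
  open PermutationReasoning
  top : List ℕ
  top = suc m ∷ suc (suc m) ∷ []
  oneTo-split : oneTo (suc (suc m)) ≡ oneTo m ++ top
  oneTo-split = trans (oneTo-suc (suc m))
    (trans (cong (_++ [ suc (suc m) ]) (oneTo-suc m)) (++-assoc (oneTo m) [ suc m ] [ suc (suc m) ]))
  fixes-oneTo : map (swapTop m) (oneTo m) ≡ oneTo m
  fixes-oneTo = map-id-local (All.map (λ y≤ → transp-fixed (≤⇒≢suc y≤) (≤⇒≢suc (m≤n⇒m≤1+n y≤))) (oneTo-≤ m))

pos-deleteV-swapTop : IsPerm (suc (suc m)) xs → pos (suc m) xs ≮ pos (suc (suc m)) xs →
  pos (suc m) (deleteV (suc (suc m)) (map (swapTop m) xs)) ≡ pos (suc (suc m)) xs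
pos-deleteV-swapTop {m} {xs} p m+1≮N = begin
  pos (suc m) (deleteV N ys)  ≡⟨ pos-deleteV ys (≤⇒≢suc ≤-refl) m+1-before-N ⟩
  pos (suc m) ys              ≡⟨ pos-swapTop-N ⟩
  pos N xs                    ∎
  where
  open ≡-Reasoning
  N : ℕ
  N = suc (suc m)
  ys : List ℕ
  ys = map (swapTop m) xs
  pos-swapTop : ∀ v → pos (swapTop m v) ys ≡ pos v xs
  pos-swapTop v = pos-map-involutive (swapTop m) xs (transp-involutive (suc m) N)
  pos-swapTop-N : pos (suc m) ys ≡ pos N xs
  pos-swapTop-N = trans (cong (λ v → pos v ys) (sym (transp-right (suc m) N))) (pos-swapTop N)
  pos-swapTop-m+1 : pos N ys ≡ pos (suc m) xs
  pos-swapTop-m+1 = trans (cong (λ v → pos v ys) (sym (transp-left (suc m) N))) (pos-swapTop (suc m))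
  N-before-m+1 : pos N xs < pos (suc m) xs
  N-before-m+1 = ≤∧≢⇒< (≮⇒≥ m+1≮N) (≤⇒≢suc ≤-refl ∘ sym ∘ pos-injective (IsPerm⇒last∈ p))
  m+1-before-N : pos (suc m) ys < pos N ys
  m+1-before-N = subst₂ _<_ (sym pos-swapTop-N) (sym pos-swapTop-m+1) N-before-m+1

maxL-≤ : All (_≤ n) xs → maxL xs ≤ n
maxL-≤ [] = z≤n
maxL-≤ (x≤ ∷ xs≤) = ⊔-lub x≤ (maxL-≤ xs≤)

1≤bl : ∀ n xs → All (_≤ suc n) xs → 1 ≤ bl (suc n) xs
1≤bl n xs xs≤ = 1≤length (∈-filter⁺ (λ i → T? (maxL (take i xs) ≤ᵇ i)) (last∈oneTo n)
                                    (≤⇒≤ᵇ (maxL-≤ (All.take⁺ (suc n) xs≤))))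
  where
  1≤length : ∀ {y ys} → y ∈ ys → 1 ≤ length ys
  1≤length (here _) = s≤s z≤n
  1≤length (there _) = s≤s z≤n

∸bl≤ : IsPerm (suc n) xs → suc n ∸ bl (suc n) xs ≤ n
∸bl≤ {n} {xs} p = ∸-monoʳ-≤ (suc n) (1≤bl n xs (IsPerm⇒≤ p))

length-++-[_] : ∀ {A : Set} (x : A) xs → length (xs ++ [ x ]) ≡ suc (length xs)
length-++-[ x ] xs = trans (length-++ xs) (+-comm (length xs) 1)

f-≤ : ∀ m xs → All (_≤ suc m) xs → All (_≤ suc m) (f (suc m) xs)
f-≤ zero xs xs≤ = xs≤
f-≤ (suc m) π π≤ with pos (suc (suc m)) π ≡ᵇ suc (suc m)
... | true = All.++⁺ (weaken-≤ (f-≤ m (deleteV N π) (deleteV-≤ π≤))) (≤-refl ∷ [])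
  where N = suc (suc m)
... | false with pos (suc m) π <ᵇ pos (suc (suc m)) π
...   | true = All.map⁺ (All.map (transp-≤ (≤-trans (m∸n≤m (N ∸ k) 1) (m∸n≤m N k)) (m∸n≤m N k))
                 (All-insertAt (pos N π) ≤-refl (weaken-≤ (f-≤ m (deleteV N π) (deleteV-≤ π≤)))))
  where
  N k : ℕ
  N = suc (suc m)
  k = bl N π
...   | false = All.map⁺ (All.map (cyc-≤ (m∸n≤m N k))
                  (All.++⁺ (weaken-≤ (f-≤ m (deleteV N π') (deleteV-≤ π'≤))) (≤-refl ∷ [])))
  where
  N k : ℕ
  N = suc (suc m)
  k = bl N π
  π' : List ℕ
  π' = map (swapTop m) π
  π'≤ : All (_≤ N) π'
  π'≤ = All.map⁺ (All.map (transp-≤ (n≤1+n (suc m)) ≤-refl) π≤)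

length-f : ∀ m xs → IsPerm (suc m) xs → length (f (suc m) xs) ≡ suc m
length-f zero xs p = IsPerm⇒length p
length-f (suc m) π p with pos (suc (suc m)) π ≡ᵇ suc (suc m)
... | true = trans (length-++-[ N ] L) (cong suc (length-f m (deleteV N π) (IsPerm-deleteV p)))
  where
  N : ℕ
  N = suc (suc m)
  L : List ℕ
  L = f (suc m) (deleteV N π)
... | false with pos (suc m) π <ᵇ pos (suc (suc m)) π
...   | true = trans (length-map _ (insertAt (pos N π) N L))
                 (trans (length-insertAt (pos N π)) (cong suc (length-f m (deleteV N π) (IsPerm-deleteV p))))
  where
  N : ℕ
  N = suc (suc m)
  L : List ℕ
  L = f (suc m) (deleteV N π)
...   | false = trans (length-map _ (L ++ [ N ]))
                  (trans (length-++-[ N ] L) (cong suc (length-f m ρ (IsPerm-deleteV (IsPerm-swapTop p)))))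
  where
  N : ℕ
  N = suc (suc m)
  ρ L : List ℕ
  ρ = deleteV N (map (swapTop m) π)
  L = f (suc m) ρ

f-∌ : ∀ m xs → IsPerm (suc m) xs → All (_≢ suc (suc m)) (f (suc m) xs)
f-∌ m xs p = All.map ≤⇒≢suc (f-≤ m xs (IsPerm⇒≤ p))

pos-transp-insertAt : ∀ p → a ≤ n → b ≤ n → All (_≢ suc n) xs → 1 ≤ p → p ≤ suc (length xs) →
  pos (suc n) (map (transp a b) (insertAt p (suc n) xs)) ≡ p
pos-transp-insertAt {a} {n} {b} {xs} p a≤n b≤n xs∌ 1≤p p≤ = begin
  pos (suc n) (map t zs)      ≡⟨ cong (λ v → pos v (map t zs)) (sym t-fixes-suc-n) ⟩
  pos (t (suc n)) (map t zs)  ≡⟨ pos-map-involutive t zs (transp-involutive a b) ⟩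
  pos (suc n) zs              ≡⟨ pos-insertAt p xs∌ 1≤p p≤ ⟩
  p                           ∎
  where
  open ≡-Reasoning
  t : ℕ → ℕ
  t = transp a b
  zs : List ℕ
  zs = insertAt p (suc n) xs
  t-fixes-suc-n : t (suc n) ≡ suc n
  t-fixes-suc-n = transp-fixed (≤⇒≢suc a≤n ∘ sym) (≤⇒≢suc b≤n ∘ sym)

pos-cyc-++ : ∀ xs → a ≤ n → pos n xs ≤ length xs →
  pos (suc n) (map (cyc a (suc n)) (xs ++ [ suc n ])) ≡ pos n xs
pos-cyc-++ {a} {n} xs a≤n n∈xs = begin
  pos (suc n) (map (cyc a (suc n)) (xs ++ [ suc n ]))
    ≡⟨ pos-map (cyc a (suc n)) (xs ++ [ suc n ]) (cyc-last a≤n) (λ _ → cyc-preimage-last (≤⇒≢suc a≤n)) ⟩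
  pos n (xs ++ [ suc n ])     ≡⟨ pos-++ˡ xs [ suc n ] n∈xs ⟩
  pos n xs                    ∎
  where open ≡-Reasoning

pos-f : ∀ m xs → IsPerm (suc m) xs → pos (suc m) (f (suc m) xs) ≡ pos (suc m) xs
pos-f zero xs p = refl
pos-f (suc m) π p with pos (suc (suc m)) π ≡ᵇ suc (suc m) in caseA
... | true = begin
  pos N (L ++ [ N ])  ≡⟨ pos-++-last (f-∌ m (deleteV N π) (IsPerm-deleteV p)) ⟩
  suc (length L)      ≡⟨ cong suc (length-f m (deleteV N π) (IsPerm-deleteV p)) ⟩
  N                   ≡⟨ sym (≡ᵇ-true⇒≡ caseA) ⟩
  pos N π             ∎
  where
  open ≡-Reasoning
  N : ℕ
  N = suc (suc m)
  L : List ℕ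
  L = f (suc m) (deleteV N π)
... | false with pos (suc m) π <ᵇ pos (suc (suc m)) π in caseB
...   | true = pos-transp-insertAt (pos N π) (≤-trans (m∸n≤m (N ∸ k) 1) (∸bl≤ p)) (∸bl≤ p)
                 (f-∌ m (deleteV N π) (IsPerm-deleteV p)) (1≤pos N π) N-fits
  where
  N k : ℕ
  N = suc (suc m)
  k = bl N π
  N-fits : pos N π ≤ suc (length (f (suc m) (deleteV N π)))
  N-fits = ≤-trans (pos≤length (IsPerm⇒last∈ p))
    (≤-reflexive (trans (IsPerm⇒length p) (cong suc (sym (length-f m (deleteV N π) (IsPerm-deleteV p))))))
...   | false = begin
  pos N (map (cyc (N ∸ k) N) (L ++ [ N ]))  ≡⟨ pos-cyc-++ L (∸bl≤ p) (subst (_≤ length L) (sym IH) m+1∈L) ⟩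
  pos (suc m) L                             ≡⟨ IH ⟩
  pos (suc m) ρ                             ≡⟨ pos-deleteV-swapTop p (<ᵇ-false⇒≮ caseB) ⟩
  pos N π                                   ∎
  where
  open ≡-Reasoning
  N k : ℕ
  N = suc (suc m)
  k = bl N π
  ρ L : List ℕ
  ρ = deleteV N (map (swapTop m) π)
  L = f (suc m) ρ
  pρ : IsPerm (suc m) ρ
  pρ = IsPerm-deleteV (IsPerm-swapTop p)
  IH : pos (suc m) L ≡ pos (suc m) ρ
  IH = pos-f m ρ pρ
  m+1∈L : pos (suc m) ρ ≤ length L
  m+1∈L = ≤-trans (pos≤length (IsPerm⇒last∈ pρ)) (≤-reflexive (trans (IsPerm⇒length pρ) (sym (length-f m ρ pρ))))

lemma4p8 : (n : ℕ) → 1 ≤ n → (π : List ℕ) → S321 n π →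
    pos n (f n π) ≡ pos n π
lemma4p8 (suc m) _ π (isPerm , _) = pos-f m π isPerm
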